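{- Let $G$ be a triangulation of the sphere, and let $U,U_0,\overline{U_0}\subseteq V(G)$ and $d_U\ge 0$ satisfy the $U$-conditions for $G$, with $|U_0|>1$. Let $T_0$ be a Steiner tree for $U_0$ in $G$, let $U_0'=U_0\cup\{v\in V(T_0):\deg_{T_0}(v)\neq 2\}$, let $P_0$ be a path of maximum length among the maximal paths of $T_0$ having no internal vertex in $U_0'$, and let $x$ be a vertex of $P_0$ whose distance along $P_0$ from one endpoint of $P_0$ equals $\lfloor |P_0|/2\rfloor$. Then for every integer $i$ with $0\le i<\lfloor |P_0|/2\rfloor-d_U$, the set $N_i(x)$ does not intersect $U$.
   Context: Graphs are finite and simple; a triangulation of the sphere is a simple graph embedded on the sphere with every face bounded by a triangle. Sets $U,U_0,\overline{U_0}\subseteq V(G)$ and an integer $d_U\ge 0$ satisfy the $U$-conditions for $G$ if: (1) $U$ is the disjoint union of $U_0$ and $\overline{U_0}$; (2) every vertex of degree different from $6$ lies in $U$; (3) every component of $G[U]$ contains a vertex of $U_0$; (4) every $v\in\overline{U_0}$ has some $u\in U_0$ at distance at most $d_U$ in $G$. A Steiner tree for $U_0$ is a subtree of $G$ containing $U_0$ with the minimum possible number of edges. The edge set of $T_0$ is partitioned by the maximal paths of $T_0$ with both endpoints in $U_0'$ and no internal vertex in $U_0'$. The length $|P|$ of a path is its number of edges. $N_i(x)$ is the set of vertices of $G$ at distance exactly $i$ from $x$ in $G$. -}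

module Defs where

open import Data.Nat using (ℕ; zero; suc; _+_; _≤_; _<_; _/_)
open import Data.Bool using (Bool; true; false; if_then_else_; _∧_)
open import Data.Fin using (Fin; toℕ; _≟_)
open import Data.List using (List; []; _∷_; _++_; [_]; length; filter; allFin)
open import Data.List.Membership.Propositional using (_∈_)
open import Data.List.Relation.Unary.All using (All)
open import Data.List.Relation.Unary.Unique.Propositional using (Unique)
open import Data.List.Relation.Unary.Linked using (Linked)
open import Data.Product using (Σ; ∃; ∃-syntax; _×_)
open import Data.Sum using (_⊎_)
open import Relation.Nullary using (¬_)
open import Relation.Nullary.Decidable using (⌊_⌋)
open import Relation.Binary.PropositionalEquality using (_≡_; _≢_)

VSet : ℕ → Set
VSet n = Fin n → Bool

ERel : ℕ → Set
ERel n = Fin n → Fin n → Bool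

_∈ₛ_ : ∀ {n} → Fin n → VSet n → Set
v ∈ₛ S = S v ≡ true

card : ∀ {n} → VSet n → ℕ
card {n} S = length (filter (λ v → S v Data.Bool.≟ true) (allFin n))

record Graph (n : ℕ) : Set where
  field
    adj   : ERel n
    sym   : ∀ u v → adj u v ≡ true → adj v u ≡ true
    irrefl : ∀ v → adj v v ≡ false
open Graph public

degIn : ∀ {n} → ERel n → Fin n → ℕ
degIn {n} E v = card (E v)

edgeCount : ∀ {n} → ERel n → ℕ
edgeCount {n} E =
  length (filter (λ p → Data.Bool._≟_ (E (Data.Product.proj₁ p) (Data.Product.proj₂ p)
                                    ∧ ⌊ toℕ (Data.Product.proj₁ p) Data.Nat.<? toℕ (Data.Product.proj₂ p) ⌋) true)
         (Data.List.cartesianProduct (allFin n) (allFin n)))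

data Walk {n : ℕ} (E : ERel n) : Fin n → Fin n → ℕ → Set where
  here : ∀ {u} → Walk E u u 0
  step : ∀ {u v w k} → E u v ≡ true → Walk E v w k → Walk E u w (suc k)

DistEq : ∀ {n} → Graph n → Fin n → Fin n → ℕ → Set
DistEq G x y i = Walk (adj G) x y i × (∀ j → j < i → ¬ Walk (adj G) x y j)

DistLe : ∀ {n} → Graph n → Fin n → Fin n → ℕ → Set
DistLe G x y d = ∃[ j ] (j ≤ d × Walk (adj G) x y j)

N : ∀ {n} → Graph n → ℕ → Fin n → Fin n → Set
N G i x y = DistEq G x y i

Connected : ∀ {n} → Graph n → Set
Connected G = ∀ u v → ∃[ k ] Walk (adj G) u v k

induced : ∀ {n} → Graph n → VSet n → ERel n
induced G S u v = adj G u v ∧ S u ∧ S v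

-- Triangulations of the sphere, via rotation systems (Heffter–Edmonds).
-- rot v lists the neighbours of v in their cyclic (clockwise) order.
-- The face-tracing map sends the dart (u , v) to (v , succ (rot v) u).

nextAfter : ∀ {n} → Fin n → List (Fin n) → Fin n → Fin n
nextAfter first []          x = first
nextAfter first (y ∷ [])    x = first
nextAfter first (y ∷ z ∷ r) x = if ⌊ y ≟ x ⌋ then z else nextAfter first (z ∷ r) x

cycSucc : ∀ {n} → List (Fin n) → Fin n → Fin n
cycSucc []      x = x
cycSucc (h ∷ t) x = nextAfter h (h ∷ t) x

-- number of faces when every face is a triangle: count darts (u , v)
-- such that u is the smallest vertex of the face (u , v , w)
triFaceCount : ∀ {n} → Graph n → (Fin n → List (Fin n)) → ℕ
triFaceCount {n} G rot =
  length (filter (λ p → Data.Bool._≟_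
            (adj G (Data.Product.proj₁ p) (Data.Product.proj₂ p)
             ∧ ⌊ toℕ (Data.Product.proj₁ p) Data.Nat.<? toℕ (Data.Product.proj₂ p) ⌋
             ∧ ⌊ toℕ (Data.Product.proj₁ p) Data.Nat.<?
                 toℕ (cycSucc (rot (Data.Product.proj₂ p)) (Data.Product.proj₁ p)) ⌋) true)
         (Data.List.cartesianProduct (allFin n) (allFin n)))

record SphereTriangulation {n : ℕ} (G : Graph n) : Set where
  field
    rot        : Fin n → List (Fin n)
    rot-nbrs   : ∀ u v → (v ∈ rot u → adj G u v ≡ true) × (adj G u v ≡ true → v ∈ rot u)
    rot-unique : ∀ u → Unique (rot u)
    connected  : Connected G
    -- every face is bounded by a triangle: the face walk closes after 3 steps
    triangular : ∀ u v → adj G u v ≡ true →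
                 let w = cycSucc (rot v) u in
                 (cycSucc (rot w) v ≡ u) × (cycSucc (rot u) w ≡ v)
    -- Euler's formula V - E + F = 2 (genus 0, i.e. the sphere)
    euler      : n + triFaceCount G rot ≡ 2 + edgeCount (adj G)

record UConditions {n : ℕ} (G : Graph n) (U U₀ U₀bar : VSet n) (dU : ℕ) : Set where
  field
    union     : ∀ v → (v ∈ₛ U → v ∈ₛ U₀ ⊎ v ∈ₛ U₀bar) × (v ∈ₛ U₀ ⊎ v ∈ₛ U₀bar → v ∈ₛ U)
    disjoint  : ∀ v → ¬ (v ∈ₛ U₀ × v ∈ₛ U₀bar)
    deg≠6     : ∀ v → degIn (adj G) v ≢ 6 → v ∈ₛ U
    compU₀    : ∀ u → u ∈ₛ U → ∃[ w ] (w ∈ₛ U₀ × ∃[ k ] Walk (induced G U) u w k)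
    near      : ∀ v → v ∈ₛ U₀bar → ∃[ u ] (u ∈ₛ U₀ × DistLe G v u dU)

IsPath : ∀ {n} → ERel n → List (Fin n) → Set
IsPath E p = Unique p × Linked (λ a b → E a b ≡ true) p

HasCycle : ∀ {n} → ERel n → Set
HasCycle E = ∃[ v ] ∃[ r ] (Unique (v ∷ r) × 2 ≤ length r
                            × Linked (λ a b → E a b ≡ true) (v ∷ r ++ [ v ]))

record SubTree {n : ℕ} (G : Graph n) : Set where
  field
    VT       : VSet n
    ET       : ERel n
    ET⊆G     : ∀ u v → ET u v ≡ true → adj G u v ≡ true
    ET-sym   : ∀ u v → ET u v ≡ true → ET v u ≡ true
    ET-ends  : ∀ u v → ET u v ≡ true → u ∈ₛ VT
    nonempty : ∃[ v ] v ∈ₛ VT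
    conn     : ∀ u v → u ∈ₛ VT → v ∈ₛ VT → ∃[ k ] Walk ET u v k
    acyclic  : ¬ HasCycle ET
open SubTree public

Contains : ∀ {n} {G : Graph n} → SubTree G → VSet n → Set
Contains T S = ∀ v → v ∈ₛ S → v ∈ₛ VT T

IsSteinerTree : ∀ {n} (G : Graph n) → VSet n → SubTree G → Set
IsSteinerTree G S T =
  Contains T S × (∀ (T' : SubTree G) → Contains T' S → edgeCount (ET T) ≤ edgeCount (ET T'))

U₀' : ∀ {n} {G : Graph n} → VSet n → SubTree G → Fin n → Set
U₀' U₀ T v = v ∈ₛ U₀ ⊎ (v ∈ₛ VT T × degIn (ET T) v ≢ 2)

record Segment {n : ℕ} {G : Graph n} (U₀ : VSet n) (T : SubTree G) : Set where
  field
    a    : Fin n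
    mid  : List (Fin n)
    b    : Fin n
    path : IsPath (ET T) (a ∷ mid ++ [ b ])
    endA : U₀' U₀ T a
    endB : U₀' U₀ T b
    inner : All (λ v → ¬ U₀' U₀ T v) mid

segVerts : ∀ {n} {G : Graph n} {U₀ : VSet n} {T : SubTree G} → Segment U₀ T → List (Fin n)
segVerts P = Segment.a P ∷ Segment.mid P ++ [ Segment.b P ]

segLen : ∀ {n} {G : Graph n} {U₀ : VSet n} {T : SubTree G} → Segment U₀ T → ℕ
segLen P = suc (length (Segment.mid P))

-- The proof is an exchange argument that uses only the minimality of T₀.
-- A vertex y ∈ U at distance i from x yields, by the U-conditions, a
-- terminal u ∈ U₀ joined to x by a walk of length k ≤ i + d_U.  Deleting
-- the edges of P₀ separates the two ends a, b of P₀ (its interior vertices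
-- have degree 2 in T₀), and u lies on the side of one of them, say a.
-- Replacing the part of P₀ between a and x by the walk from x to u keeps
-- all terminals connected, so by minimality of T₀ that part, of length at
-- least ⌊|P₀|/2⌋, has at most k edges, contradicting k ≤ i + d_U < ⌊|P₀|/2⌋.

module Submission where

open import Defs hiding (sym)
open import Data.Nat as ℕ using (ℕ; zero; suc; _+_; _≤_; _<_; _/_; s≤s; z≤n; _<?_; _≤?_)
open import Data.Nat.Properties
open import Data.Nat.DivMod using (m/n*n≤m)
open import Data.Bool using (Bool; true; false; _∧_; _∨_; not)
import Data.Bool as Bool
open import Data.Bool.Properties using (∨-comm; ∨-assoc; ∨-identityʳ; ∧-identityʳ; T-≡)
open import Data.Fin using (Fin; toℕ)
import Data.Fin as Fin
import Data.Fin.Properties as Fin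
open import Data.List using (List; []; _∷_; _++_; [_]; length; filter; allFin; cartesianProduct)
open import Data.Bool.ListAction using (any)
open import Data.List.Properties using (length-++; ∷-injectiveˡ; ∷-injectiveʳ)
open import Data.List.Membership.Propositional using (_∈_; _∉_)
open import Data.List.Membership.Propositional.Properties
  using (∈-allFin; ∈-cartesianProduct⁺; ∈-++⁺ʳ; ∈-++⁻)
import Data.List.Membership.DecPropositional as DecMembership
open import Data.List.Relation.Unary.Any as Any using (here; there)
open import Data.List.Relation.Unary.Any.Properties using (any⁺; any⁻)
open import Data.List.Relation.Unary.All as All using (All; []; _∷_)
open import Data.List.Relation.Unary.AllPairs using ([]; _∷_)
open import Data.List.Relation.Unary.Unique.Propositional using (Unique)
open import Data.List.Relation.Unary.Unique.Propositional.Properties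
  using (allFin⁺; cartesianProduct⁺)
open import Data.List.Relation.Unary.Linked as Linked using (Linked; []; [-]; _∷_)
open import Data.Product as Product using (_×_; _,_; proj₁; proj₂; ∃-syntax)
open import Data.Sum as Sum using (_⊎_; inj₁; inj₂)
open import Data.Empty using (⊥; ⊥-elim)
open import Relation.Nullary using (¬_; Dec; yes; no)
open import Relation.Nullary.Decidable using (⌊_⌋; decidable-stable; ¬¬-excluded-middle)
open import Relation.Nullary.Negation using (¬¬-map)
open import Function.Bundles using (Equivalence)
open import Relation.Binary.Definitions using (tri<; tri≈; tri>)
open import Relation.Binary.PropositionalEquality
  using (_≡_; _≢_; refl; sym; trans; cong; subst; module ≡-Reasoning)

∧-elim : ∀ {a b} → a ∧ b ≡ true → a ≡ true × b ≡ true
∧-elim {true} {true} refl = refl , refl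

∧-intro : ∀ {a b} → a ≡ true → b ≡ true → a ∧ b ≡ true
∧-intro refl refl = refl

∨-elim : ∀ {a b} → a ∨ b ≡ true → a ≡ true ⊎ b ≡ true
∨-elim {true} _ = inj₁ refl
∨-elim {false} h = inj₂ h

∨-introˡ : ∀ {a b} → a ≡ true → a ∨ b ≡ true
∨-introˡ refl = refl

∨-introʳ : ∀ {a b} → b ≡ true → a ∨ b ≡ true
∨-introʳ {true} _ = refl
∨-introʳ {false} h = h

not-elim : ∀ {b} → not b ≡ true → b ≡ false
not-elim {false} _ = refl

not-intro : ∀ {b} → b ≡ false → not b ≡ true
not-intro refl = refl

∧-not-∨ : ∀ a x y → a ∧ not (x ∨ y) ≡ (a ∧ not y) ∧ not x
∧-not-∨ false x     y     = refl
∧-not-∨ true  true  true  = refl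
∧-not-∨ true  true  false = refl
∧-not-∨ true  false true  = refl
∧-not-∨ true  false false = refl

false≢true : false ≢ true
false≢true ()

module Counting {A : Set} where

  count : (A → Bool) → List A → ℕ
  count f xs = length (filter (λ p → f p Bool.≟ true) xs)

  count-mono : (f g : A → Bool) (xs : List A) →
               (∀ p → p ∈ xs → g p ≡ true → f p ≡ true) → count g xs ≤ count f xs
  count-mono f g [] h = z≤n
  count-mono f g (y ∷ ys) h with g y in gy | f y in fy
  ... | true  | true  = s≤s (count-mono f g ys (λ p m → h p (there m)))
  ... | true  | false = ⊥-elim (false≢true (trans (sym fy) (h y (here refl) gy)))
  ... | false | true  = m≤n⇒m≤1+n (count-mono f g ys (λ p m → h p (there m)))
  ... | false | false = count-mono f g ys (λ p m → h p (there m))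

  count-drop : (f g : A → Bool) (xs : List A) →
               (∀ p → p ∈ xs → g p ≡ true → f p ≡ true) →
               ∀ x → x ∈ xs → f x ≡ true → g x ≡ false → suc (count g xs) ≤ count f xs
  count-drop f g (y ∷ ys) h x (here refl) fx gx rewrite fx | gx =
    s≤s (count-mono f g ys (λ p m → h p (there m)))
  count-drop f g (y ∷ ys) h x (there x∈) fx gx with g y in gy | f y in fy
  ... | true  | true  = s≤s (count-drop f g ys (λ p m → h p (there m)) x x∈ fx gx)
  ... | true  | false = ⊥-elim (false≢true (trans (sym fy) (h y (here refl) gy)))
  ... | false | true  = m≤n⇒m≤1+n (count-drop f g ys (λ p m → h p (there m)) x x∈ fx gx)
  ... | false | false = count-drop f g ys (λ p m → h p (there m)) x x∈ fx gx

  count-∷ : (f : A → Bool) (y : A) (ys : List A) → count f ys ≤ count f (y ∷ ys)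
  count-∷ f y ys with f y
  ... | true  = n≤1+n _
  ... | false = ≤-refl

  count-extra : (f g : A → Bool) (D : A → Set) (xs : List A) → Unique xs →
                (∀ p → p ∈ xs → g p ≡ true → f p ≡ true ⊎ D p) →
                (∀ p q → D p → D q → p ≡ q) → count g xs ≤ suc (count f xs)
  count-extra f g D [] _ _ _ = z≤n
  count-extra f g D (y ∷ ys) (y∉ys ∷ u) h D-unique with g y in gy
  ... | false = ≤-trans (count-extra f g D ys u (λ p m → h p (there m)) D-unique)
                        (s≤s (count-∷ f y ys))
  ... | true with h y (here refl) gy
  ...   | inj₁ fy rewrite fy = s≤s (count-extra f g D ys u (λ p m → h p (there m)) D-unique)
  ...   | inj₂ Dy = s≤s (≤-trans (count-mono f g ys below-f) (count-∷ f y ys))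
    where
      below-f : ∀ p → p ∈ ys → g p ≡ true → f p ≡ true
      below-f p p∈ gp with h p (there p∈) gp
      ... | inj₁ fp = fp
      ... | inj₂ Dp = ⊥-elim (All.lookup y∉ys p∈ (D-unique y p Dy Dp))

open Counting

module _ {n : ℕ} where

  infix  4 _⊆ᴱ_
  infixl 6 _∪ᴱ_ _∖ᴱ_

  _⊆ᴱ_ : ERel n → ERel n → Set
  E ⊆ᴱ F = ∀ s t → E s t ≡ true → F s t ≡ true

  Symmetric : ERel n → Set
  Symmetric E = ∀ s t → E s t ≡ true → E t s ≡ true

  _∪ᴱ_ : ERel n → ERel n → ERel n
  (E ∪ᴱ F) s t = E s t ∨ F s t

  _∖ᴱ_ : ERel n → ERel n → ERel n
  (E ∖ᴱ F) s t = E s t ∧ not (F s t)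

  ∪-introʳ : (E F : ERel n) → F ⊆ᴱ E ∪ᴱ F
  ∪-introʳ E F s t = ∨-introʳ {E s t}

  ∖-⊆ : (E F : ERel n) → E ∖ᴱ F ⊆ᴱ E
  ∖-⊆ E F s t h = proj₁ (∧-elim h)

  ∪-sym : {E F : ERel n} → Symmetric E → Symmetric F → Symmetric (E ∪ᴱ F)
  ∪-sym {E} {F} symE symF s t h with ∨-elim {E s t} h
  ... | inj₁ e = ∨-introˡ (symE s t e)
  ... | inj₂ f = ∨-introʳ {E t s} (symF s t f)

  ∖-sym : {E F : ERel n} → Symmetric E → Symmetric F → Symmetric (E ∖ᴱ F)
  ∖-sym {E} {F} symE symF s t h with ∧-elim {E s t} h | F t s in fts
  ... | e , _  | false = ∧-intro (symE s t e) refl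
  ... | _ , ¬f | true  = ⊥-elim (false≢true (trans (sym (not-elim ¬f)) (symF t s fts)))

  _==_ : Fin n → Fin n → Bool
  s == t = ⌊ s Fin.≟ t ⌋

  ==-refl : (s : Fin n) → s == s ≡ true
  ==-refl s with s Fin.≟ s
  ... | yes _ = refl
  ... | no s≢s = ⊥-elim (s≢s refl)

  ==-elim : {s t : Fin n} → s == t ≡ true → s ≡ t
  ==-elim {s} {t} h with s Fin.≟ t
  ... | yes s≡t = s≡t

  edge : Fin n → Fin n → ERel n
  edge c d s t = (s == c ∧ t == d) ∨ (s == d ∧ t == c)

  edge-elim : ∀ {c d s t} → edge c d s t ≡ true → (s ≡ c × t ≡ d) ⊎ (s ≡ d × t ≡ c)
  edge-elim h with ∨-elim h
  ... | inj₁ h₁ = inj₁ (==-elim (proj₁ (∧-elim h₁)) , ==-elim (proj₂ (∧-elim h₁)))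
  ... | inj₂ h₂ = inj₂ (==-elim (proj₁ (∧-elim h₂)) , ==-elim (proj₂ (∧-elim h₂)))

  edge-here : (c d : Fin n) → edge c d c d ≡ true
  edge-here c d rewrite ==-refl c | ==-refl d = refl

  edge-back : (c d : Fin n) → edge c d d c ≡ true
  edge-back c d rewrite ==-refl c | ==-refl d = ∨-introʳ {d == c ∧ c == d} refl

  edge-sym : (c d : Fin n) → Symmetric (edge c d)
  edge-sym c d s t h with edge-elim {c} {d} {s} {t} h
  ... | inj₁ (refl , refl) = edge-back c d
  ... | inj₂ (refl , refl) = edge-here c d

  edge-flip : (c d s t : Fin n) → edge c d s t ≡ edge d c s t
  edge-flip c d s t = ∨-comm (s == c ∧ t == d) (s == d ∧ t == c)

  edge-avoidˡ : ∀ {c d s t} → s ≢ c → s ≢ d → edge c d s t ≡ false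
  edge-avoidˡ {c} {d} {s} {t} s≢c s≢d with edge c d s t in e
  ... | false = refl
  ... | true with edge-elim {c} {d} {s} {t} e
  ...   | inj₁ (s≡c , _) = ⊥-elim (s≢c s≡c)
  ...   | inj₂ (s≡d , _) = ⊥-elim (s≢d s≡d)

  edge-avoidʳ : ∀ {c d s t} → t ≢ c → t ≢ d → edge c d s t ≡ false
  edge-avoidʳ {c} {d} {s} {t} t≢c t≢d with edge c d s t in e
  ... | false = refl
  ... | true with edge-elim {c} {d} {s} {t} e
  ...   | inj₁ (_ , t≡d) = ⊥-elim (t≢d t≡d)
  ...   | inj₂ (_ , t≡c) = ⊥-elim (t≢c t≡c)

module _ {n : ℕ} where

  pairs : List (Fin n × Fin n)
  pairs = cartesianProduct (allFin n) (allFin n)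

  ordered : Fin n → Fin n → Bool
  ordered s t = ⌊ toℕ s <? toℕ t ⌋

  counted : ERel n → Fin n × Fin n → Bool
  counted E (s , t) = E s t ∧ ordered s t

  ordered-intro : ∀ {s t} → toℕ s < toℕ t → ordered s t ≡ true
  ordered-intro {s} {t} s<t with toℕ s <? toℕ t
  ... | yes _ = refl
  ... | no s≮t = ⊥-elim (s≮t s<t)

  ordered-elim : ∀ {s t} → ordered s t ≡ true → toℕ s < toℕ t
  ordered-elim {s} {t} h with toℕ s <? toℕ t
  ... | yes s<t = s<t

  edgeCount-mono : (E F : ERel n) → E ⊆ᴱ F → edgeCount E ≤ edgeCount F
  edgeCount-mono E F E⊆F = count-mono (counted F) (counted E) pairs below
    where
      below : ∀ p → p ∈ pairs → counted E p ≡ true → counted F p ≡ true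
      below (s , t) _ h = ∧-intro (E⊆F s t (proj₁ (∧-elim h))) (proj₂ (∧-elim {E s t} h))

  edgeCount-≗ : (E F : ERel n) → (∀ s t → E s t ≡ F s t) → edgeCount E ≡ edgeCount F
  edgeCount-≗ E F E≗F = ≤-antisym (edgeCount-mono E F (λ s t h → trans (sym (E≗F s t)) h))
                                  (edgeCount-mono F E (λ s t h → trans (E≗F s t) h))

  private
    remove-ordered : (E : ERel n) (c d : Fin n) → E c d ≡ true → toℕ c < toℕ d →
                     suc (edgeCount (E ∖ᴱ edge c d)) ≤ edgeCount E
    remove-ordered E c d Ecd c<d =
      count-drop (counted E) (counted (E ∖ᴱ edge c d)) pairs below (c , d)
                 (∈-cartesianProduct⁺ (∈-allFin c) (∈-allFin d)) counted-cd removed-cd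
      where
        below : ∀ p → p ∈ pairs → counted (E ∖ᴱ edge c d) p ≡ true → counted E p ≡ true
        below (s , t) _ h with ∧-elim {E s t ∧ not (edge c d s t)} h
        ... | e , o = ∧-intro (proj₁ (∧-elim {E s t} e)) o
        counted-cd : counted E (c , d) ≡ true
        counted-cd rewrite Ecd | ordered-intro c<d = refl
        removed-cd : counted (E ∖ᴱ edge c d) (c , d) ≡ false
        removed-cd rewrite Ecd | edge-here c d = refl

  edgeCount-remove : (E : ERel n) → Symmetric E → (c d : Fin n) → E c d ≡ true → c ≢ d →
                     suc (edgeCount (E ∖ᴱ edge c d)) ≤ edgeCount E
  edgeCount-remove E symE c d Ecd c≢d with <-cmp (toℕ c) (toℕ d)
  ... | tri< c<d _ _ = remove-ordered E c d Ecd c<d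
  ... | tri≈ _ c≡d _ = ⊥-elim (c≢d (Fin.toℕ-injective c≡d))
  ... | tri> _ _ d<c = subst (λ m → suc m ≤ edgeCount E)
                             (edgeCount-≗ _ _ (λ s t → cong (λ b → E s t ∧ not b) (edge-flip d c s t)))
                             (remove-ordered E d c (symE c d Ecd) d<c)

  edgeCount-add : (E : ERel n) (c d : Fin n) → edgeCount (E ∪ᴱ edge c d) ≤ suc (edgeCount E)
  edgeCount-add E c d =
    count-extra (counted E) (counted (E ∪ᴱ edge c d)) New pairs
                (cartesianProduct⁺ (allFin⁺ n) (allFin⁺ n)) old-or-new new-unique
    where
      New : Fin n × Fin n → Set
      New (s , t) = edge c d s t ≡ true × ordered s t ≡ true
      old-or-new : ∀ p → p ∈ pairs → counted (E ∪ᴱ edge c d) p ≡ true → counted E p ≡ true ⊎ New p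
      old-or-new (s , t) _ h with ∧-elim {E s t ∨ edge c d s t} h
      ... | e , o with ∨-elim {E s t} e
      ...   | inj₁ old = inj₁ (∧-intro old o)
      ...   | inj₂ new = inj₂ (new , o)
      new-unique : ∀ p q → New p → New q → p ≡ q
      new-unique (s , t) (s' , t') (e , o) (e' , o')
        with edge-elim {c = c} {d = d} {s = s} {t = t} e | edge-elim {c = c} {d = d} {s = s'} {t = t'} e'
      ... | inj₁ (refl , refl) | inj₁ (refl , refl) = refl
      ... | inj₂ (refl , refl) | inj₂ (refl , refl) = refl
      ... | inj₁ (refl , refl) | inj₂ (refl , refl) = ⊥-elim (<-asym (ordered-elim o) (ordered-elim o'))
      ... | inj₂ (refl , refl) | inj₁ (refl , refl) = ⊥-elim (<-asym (ordered-elim o) (ordered-elim o'))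

module _ {n : ℕ} where

  Reach : ERel n → Fin n → Fin n → Set
  Reach E u v = ∃[ k ] Walk E u v k

  Chain : ERel n → List (Fin n) → Set
  Chain E = Linked (λ a b → E a b ≡ true)

  walk-mono : ∀ {E F : ERel n} {u v k} → E ⊆ᴱ F → Walk E u v k → Walk F u v k
  walk-mono E⊆F here = here
  walk-mono E⊆F (step e w) = step (E⊆F _ _ e) (walk-mono E⊆F w)

  walk-++ : ∀ {E : ERel n} {u v w k j} → Walk E u v k → Walk E v w j → Walk E u w (k + j)
  walk-++ here w₂ = w₂
  walk-++ (step e w₁) w₂ = step e (walk-++ w₁ w₂)

  reach-refl : ∀ {E : ERel n} {u} → Reach E u u
  reach-refl = 0 , here

  reach-edge : ∀ {E : ERel n} {u v} → E u v ≡ true → Reach E u v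
  reach-edge e = 1 , step e here

  reach-trans : ∀ {E : ERel n} {u v w} → Reach E u v → Reach E v w → Reach E u w
  reach-trans (k , w₁) (j , w₂) = k + j , walk-++ w₁ w₂

  reach-mono : ∀ {E F : ERel n} {u v} → E ⊆ᴱ F → Reach E u v → Reach F u v
  reach-mono E⊆F (k , w) = k , walk-mono E⊆F w

  reach-sym : ∀ {E : ERel n} {u v} → Symmetric E → Reach E u v → Reach E v u
  reach-sym symE (_ , here) = reach-refl
  reach-sym symE (_ , step {u} {v} e w) = reach-trans (reach-sym symE (_ , w)) (reach-edge (symE u v e))

  walkTail : ∀ {E : ERel n} {u v k} → Walk E u v k → List (Fin n)
  walkTail here = []
  walkTail (step {v = v} e w) = v ∷ walkTail w

  walkTail-chain : ∀ {E : ERel n} {u v k} (w : Walk E u v k) → Chain E (u ∷ walkTail w)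
  walkTail-chain here = [-]
  walkTail-chain (step e w) = e ∷ walkTail-chain w

  walkTail-length : ∀ {E : ERel n} {u v k} (w : Walk E u v k) → length (walkTail w) ≡ k
  walkTail-length here = refl
  walkTail-length (step e w) = cong suc (walkTail-length w)

  walkTail-end : ∀ {E : ERel n} {u v k} (w : Walk E u v k) → v ∈ u ∷ walkTail w
  walkTail-end here = here refl
  walkTail-end (step e w) = there (walkTail-end w)

  pathEdges : List (Fin n) → ERel n
  pathEdges []          s t = false
  pathEdges (c ∷ [])    s t = false
  pathEdges (c ∷ d ∷ r)     = edge c d ∪ᴱ pathEdges (d ∷ r)

  pathEdges-sym : (p : List (Fin n)) → Symmetric (pathEdges p)
  pathEdges-sym []          s t ()
  pathEdges-sym (c ∷ [])    s t ()
  pathEdges-sym (c ∷ d ∷ r) = ∪-sym (edge-sym c d) (pathEdges-sym (d ∷ r))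

  pathEdges-ends : ∀ c r s t → pathEdges (c ∷ r) s t ≡ true → s ∈ c ∷ r × t ∈ c ∷ r
  pathEdges-ends c (d ∷ r) s t h with ∨-elim {edge c d s t} h
  ... | inj₂ later = Product.map there there (pathEdges-ends d r s t later)
  ... | inj₁ first with edge-elim {c = c} {d = d} {s = s} {t = t} first
  ...   | inj₁ (refl , refl) = here refl , there (here refl)
  ...   | inj₂ (refl , refl) = there (here refl) , here refl

  pathEdges-⊆ : ∀ {E : ERel n} → Symmetric E → ∀ c r → Chain E (c ∷ r) → pathEdges (c ∷ r) ⊆ᴱ E
  pathEdges-⊆ symE c (d ∷ r) (e ∷ chain) s t h with ∨-elim {edge c d s t} h
  ... | inj₂ later = pathEdges-⊆ symE d r chain s t later
  ... | inj₁ first with edge-elim {c = c} {d = d} {s = s} {t = t} first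
  ...   | inj₁ (refl , refl) = e
  ...   | inj₂ (refl , refl) = symE c d e

  pathEdges-reach : ∀ c r {s} → s ∈ c ∷ r → Reach (pathEdges (c ∷ r)) c s
  pathEdges-reach c r (here refl) = reach-refl
  pathEdges-reach c (d ∷ r) (there s∈) =
    reach-trans (reach-edge (∨-introˡ (edge-here c d)))
                (reach-mono (∪-introʳ (edge c d) (pathEdges (d ∷ r))) (pathEdges-reach d r s∈))

  interior-neighbours : ∀ c m z {w} → Unique (c ∷ m ++ [ z ]) → w ∈ m →
                        ∃[ p ] ∃[ q ] (pathEdges (c ∷ m ++ [ z ]) w p ≡ true
                                       × pathEdges (c ∷ m ++ [ z ]) w q ≡ true × p ≢ q)
  interior-neighbours c (w ∷ []) z (c∉ ∷ _) (here refl) =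
    c , z , ∨-introˡ (edge-back c w) , ∨-introʳ {edge c w w z} (∨-introˡ (edge-here w z)) ,
    All.head (All.tail c∉)
  interior-neighbours c (w ∷ d ∷ m) z (c∉ ∷ _) (here refl) =
    c , d , ∨-introˡ (edge-back c w) , ∨-introʳ {edge c w w d} (∨-introˡ (edge-here w d)) ,
    All.head (All.tail c∉)
  interior-neighbours c (d ∷ m) z (_ ∷ unique) (there w∈) with interior-neighbours d m z unique w∈
  ... | p , q , wp , wq , p≢q = p , q , ∨-introʳ wp , ∨-introʳ wq , p≢q

  edgeCount-∪-path : (F : ERel n) → ∀ c r → edgeCount (F ∪ᴱ pathEdges (c ∷ r)) ≤ edgeCount F + length r
  edgeCount-∪-path F c [] =
    ≤-reflexive (trans (edgeCount-≗ _ F (λ s t → ∨-identityʳ (F s t))) (sym (+-identityʳ _)))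
  edgeCount-∪-path F c (d ∷ r) = begin
      edgeCount (F ∪ᴱ pathEdges (c ∷ d ∷ r))
        ≡⟨ edgeCount-≗ _ _ reassociate ⟩
      edgeCount (F ∪ᴱ pathEdges (d ∷ r) ∪ᴱ edge c d)
        ≤⟨ edgeCount-add (F ∪ᴱ pathEdges (d ∷ r)) c d ⟩
      suc (edgeCount (F ∪ᴱ pathEdges (d ∷ r)))
        ≤⟨ s≤s (edgeCount-∪-path F d r) ⟩
      suc (edgeCount F + length r)
        ≡⟨ sym (+-suc _ (length r)) ⟩
      edgeCount F + suc (length r) ∎
    where
      open ≤-Reasoning
      reassociate : ∀ s t → (F ∪ᴱ pathEdges (c ∷ d ∷ r)) s t ≡ (F ∪ᴱ pathEdges (d ∷ r) ∪ᴱ edge c d) s t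
      reassociate s t = trans (cong (F s t ∨_) (∨-comm (edge c d s t) (pathEdges (d ∷ r) s t)))
                              (sym (∨-assoc (F s t) (pathEdges (d ∷ r) s t) (edge c d s t)))

  edgeCount-∖-path : (E : ERel n) → Symmetric E → ∀ c r → Unique (c ∷ r) → Chain E (c ∷ r) →
                     edgeCount (E ∖ᴱ pathEdges (c ∷ r)) + length r ≤ edgeCount E
  edgeCount-∖-path E symE c [] _ _ =
    ≤-reflexive (trans (+-identityʳ _) (edgeCount-≗ _ E (λ s t → ∧-identityʳ (E s t))))
  edgeCount-∖-path E symE c (d ∷ r) (c∉ ∷ unique) (e ∷ chain) = begin
      edgeCount (E ∖ᴱ pathEdges (c ∷ d ∷ r)) + suc (length r)
        ≡⟨ +-suc _ (length r) ⟩
      suc (edgeCount (E ∖ᴱ pathEdges (c ∷ d ∷ r))) + length r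
        ≡⟨ cong (λ m → suc m + length r) (edgeCount-≗ _ _ reassociate) ⟩
      suc (edgeCount (E′ ∖ᴱ edge c d)) + length r
        ≤⟨ +-monoˡ-≤ (length r) (edgeCount-remove E′ symE′ c d E′cd (All.head c∉)) ⟩
      edgeCount E′ + length r
        ≤⟨ edgeCount-∖-path E symE d r unique chain ⟩
      edgeCount E ∎
    where
      open ≤-Reasoning
      E′ = E ∖ᴱ pathEdges (d ∷ r)
      symE′ : Symmetric E′
      symE′ = ∖-sym symE (pathEdges-sym (d ∷ r))
      reassociate : ∀ s t → (E ∖ᴱ pathEdges (c ∷ d ∷ r)) s t ≡ (E′ ∖ᴱ edge c d) s t
      reassociate s t = ∧-not-∨ (E s t) (edge c d s t) (pathEdges (d ∷ r) s t)
      c∉rest : pathEdges (d ∷ r) c d ≡ false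
      c∉rest with pathEdges (d ∷ r) c d in h
      ... | false = refl
      ... | true  = ⊥-elim (All.lookup c∉ (proj₁ (pathEdges-ends d r c d h)) refl)
      E′cd : E′ c d ≡ true
      E′cd = ∧-intro e (not-intro c∉rest)

record Connects {n : ℕ} (G : Graph n) (S : VSet n) (E : ERel n) : Set where
  field
    inG       : E ⊆ᴱ adj G
    symmetric : Symmetric E
    hub       : Fin n
    toHub     : ∀ v → v ∈ₛ S ⊎ (∃[ w ] E v w ≡ true) → Reach E v hub

module _ {n : ℕ} where

  detour : ∀ {E : ERel n} {c d s t k} → Symmetric E → Reach (E ∖ᴱ edge c d) c d →
           Walk E s t k → Reach (E ∖ᴱ edge c d) s t
  detour symE c~d here = reach-refl
  detour {E} {c} {d} symE c~d (step {s} {w} e walk) with edge c d s w in cd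
  ... | false = reach-trans (reach-edge (∧-intro e (not-intro cd))) (detour symE c~d walk)
  ... | true with edge-elim {c = c} {d = d} {s = s} {t = w} cd
  ...   | inj₁ (refl , refl) = reach-trans c~d (detour symE c~d walk)
  ...   | inj₂ (refl , refl) =
          reach-trans (reach-sym (∖-sym symE (edge-sym c d)) c~d) (detour symE c~d walk)

  cycle-edge : ∀ {E : ERel n} → Symmetric E → HasCycle E →
               ∃[ c ] ∃[ d ] (E c d ≡ true × c ≢ d × Reach (E ∖ᴱ edge c d) c d)
  cycle-edge symE (v , []     , _ , ()       , _)
  cycle-edge symE (v , _ ∷ [] , _ , s≤s () , _)
  cycle-edge {E} symE (v , d ∷ r₁ ∷ r , (v∉ ∷ d∉ ∷ _) , _ , (vd ∷ dr₁ ∷ rest)) =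
    v , d , vd , All.head v∉ , reach-sym (∖-sym symE (edge-sym v d)) d~v
    where
      avoids : All (λ w → w ≢ v × w ≢ d) (r₁ ∷ r)
      avoids = All.zipWith (λ (v≢w , d≢w) → (λ w≡v → v≢w (sym w≡v)) , (λ w≡d → d≢w (sym w≡d)))
                           (All.tail v∉ , d∉)
      keep : ∀ m → All (λ w → w ≢ v × w ≢ d) m → Chain E (m ++ [ v ]) →
             Chain (E ∖ᴱ edge v d) (m ++ [ v ])
      keep []          []                    [-]          = [-]
      keep (w ∷ [])    ((w≢v , w≢d) ∷ [])    (e ∷ [-])    = ∧-intro e (not-intro (edge-avoidˡ w≢v w≢d)) ∷ [-]
      keep (w ∷ w′ ∷ m) ((w≢v , w≢d) ∷ away) (e ∷ chain) =
        ∧-intro e (not-intro (edge-avoidˡ w≢v w≢d)) ∷ keep (w′ ∷ m) away chain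
      first : (E ∖ᴱ edge v d) d r₁ ≡ true
      first = ∧-intro dr₁ (not-intro (edge-avoidʳ {s = d} (proj₁ (All.head avoids)) (proj₂ (All.head avoids))))
      symE′ : Symmetric (E ∖ᴱ edge v d)
      symE′ = ∖-sym symE (edge-sym v d)
      d~v : Reach (E ∖ᴱ edge v d) d v
      d~v = reach-trans (reach-edge first)
              (reach-mono (pathEdges-⊆ symE′ r₁ (r ++ [ v ]) (keep (r₁ ∷ r) avoids rest))
                          (pathEdges-reach r₁ (r ++ [ v ]) (there (∈-++⁺ʳ r (here refl)))))

  connects-∖ : ∀ {G : Graph n} {S : VSet n} {E : ERel n} {c d} → Connects G S E →
               Reach (E ∖ᴱ edge c d) c d → Connects G S (E ∖ᴱ edge c d)
  connects-∖ {E = E} {c} {d} conn c~d = record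
    { inG       = λ s t h → inG s t (∖-⊆ E (edge c d) s t h)
    ; symmetric = ∖-sym symmetric (edge-sym c d)
    ; hub       = hub
    ; toHub     = λ v → λ where
        (inj₁ v∈S)     → detour symmetric c~d (proj₂ (toHub v (inj₁ v∈S)))
        (inj₂ (w , e)) → detour symmetric c~d (proj₂ (toHub v (inj₂ (w , ∖-⊆ E (edge c d) v w e))))
    }
    where open Connects conn

  incident : ERel n → Fin n → Bool
  incident E v = any (E v) (allFin n)

  treeOf : ∀ {G : Graph n} {S : VSet n} {E : ERel n} {u} → u ∈ₛ S → Connects G S E →
           ¬ HasCycle E → SubTree G
  treeOf {G} {S} {E} {u} u∈S conn acyclic = record
    { VT       = λ v → S v ∨ incident E v
    ; ET       = E
    ; ET⊆G     = inG
    ; ET-sym   = symmetric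
    ; ET-ends  = λ s t e → ∨-introʳ {S s} (incident-intro e)
    ; nonempty = u , ∨-introˡ u∈S
    ; conn     = λ s t s∈ t∈ → reach-trans (toHub s (member s∈)) (reach-sym symmetric (toHub t (member t∈)))
    ; acyclic  = acyclic
    }
    where
      open Connects conn
      incident-intro : ∀ {v w} → E v w ≡ true → incident E v ≡ true
      incident-intro {v} e = Equivalence.to T-≡
        (any⁺ (E v) (Any.map (λ { refl → Equivalence.from T-≡ e }) (∈-allFin _)))
      member : ∀ {v} → S v ∨ incident E v ≡ true → v ∈ₛ S ⊎ ∃[ w ] E v w ≡ true
      member {v} h with ∨-elim {S v} h
      ... | inj₁ v∈S = inj₁ v∈S
      ... | inj₂ inc with Any.satisfied (any⁻ (E v) (allFin n) (Equivalence.from T-≡ inc))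
      ...   | w , e = inj₂ (w , Equivalence.to T-≡ e)

  PrunedTree : Graph n → VSet n → ERel n → Set
  PrunedTree G S E = ∃[ T ] (Contains {G = G} T S × edgeCount (ET T) ≤ edgeCount E)

  -- delete cycle edges until the edge set is acyclic; the edge count bounds
  -- the number of deletions.  Whether E has a cycle is only decided up to
  -- double negation, so the conclusion is double-negated.
  prune : ∀ {G : Graph n} {S : VSet n} {u} → u ∈ₛ S →
          ∀ fuel (E : ERel n) → edgeCount E ≤ fuel → Connects G S E → ¬ ¬ PrunedTree G S E
  prune u∈S fuel E bound conn noTree = ¬¬-excluded-middle decideCycle
    where
      decideCycle : Dec (HasCycle E) → ⊥
      decideCycle (no acyclic) = noTree (treeOf u∈S conn acyclic , (λ v v∈S → ∨-introˡ v∈S) , ≤-refl)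
      decideCycle (yes cycle) with cycle-edge (Connects.symmetric conn) cycle
      ... | c , d , cd , c≢d , c~d = shorter fuel bound
        where
          smaller : suc (edgeCount (E ∖ᴱ edge c d)) ≤ edgeCount E
          smaller = edgeCount-remove E (Connects.symmetric conn) c d cd c≢d
          shorter : ∀ f → edgeCount E ≤ f → ⊥
          shorter zero    le = 1+n≰n (≤-trans smaller (≤-trans le z≤n))
          shorter (suc f) le =
            prune u∈S f (E ∖ᴱ edge c d) (≤-pred (≤-trans smaller le)) (connects-∖ conn c~d)
              (λ (T , contains , fewer) → noTree (T , contains , ≤-trans fewer (≤-trans (n≤1+n _) smaller)))

  steiner-bound : ∀ {G : Graph n} {S : VSet n} {T₀ : SubTree G} {E : ERel n} {u} →
                  IsSteinerTree G S T₀ → u ∈ₛ S → Connects G S E → edgeCount (ET T₀) ≤ edgeCount E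
  steiner-bound {T₀ = T₀} {E} (_ , minimal) u∈S conn =
    decidable-stable (edgeCount (ET T₀) ≤? edgeCount E)
      (¬¬-map (λ (T , contains , fewer) → ≤-trans (minimal T contains) fewer)
              (prune u∈S (edgeCount E) E ≤-refl conn))

module _ {n : ℕ} where

  _minus_ : VSet n → Fin n → VSet n
  (S minus x) v = S v ∧ not (v == x)

  card-minus : (S : VSet n) (x : Fin n) → x ∈ₛ S → suc (card (S minus x)) ≤ card S
  card-minus S x x∈S = count-drop S (S minus x) (allFin n) (λ v _ h → proj₁ (∧-elim {S v} h))
                                  x (∈-allFin x) x∈S removed
    where
      removed : (S minus x) x ≡ false
      removed rewrite x∈S | ==-refl x = refl

  card-≥ : (S : VSet n) (xs : List (Fin n)) → Unique xs → All (_∈ₛ S) xs → length xs ≤ card S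
  card-≥ S []       _              _          = z≤n
  card-≥ S (x ∷ xs) (x∉xs ∷ unique) (x∈S ∷ xs⊆S) =
    ≤-trans (s≤s (card-≥ (S minus x) xs unique (All.zipWith still-in (x∉xs , xs⊆S))))
            (card-minus S x x∈S)
    where
      still-in : ∀ {v} → x ≢ v × v ∈ₛ S → v ∈ₛ (S minus x)
      still-in {v} (x≢v , v∈S) with v Fin.≟ x
      ... | yes v≡x = ⊥-elim (x≢v (sym v≡x))
      ... | no _    = ∧-intro v∈S refl

-- A path c ∷ m ++ [ z ] of E whose interior vertices all have E-degree 2.
-- Every E-edge at an interior vertex is then a path edge, so once the path
-- edges are deleted, a walk from outside the interior can only meet the
-- path at its two ends.
module PathCut {n : ℕ} {E : ERel n} (symE : Symmetric E)
               (c : Fin n) (m : List (Fin n)) (z : Fin n)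
               (isPath : IsPath E (c ∷ m ++ [ z ]))
               (degree-2 : ∀ {w} → w ∈ m → degIn E w ≡ 2) where

  verts : List (Fin n)
  verts = c ∷ m ++ [ z ]

  rest : ERel n
  rest = E ∖ᴱ pathEdges verts

  rest-sym : Symmetric rest
  rest-sym = ∖-sym symE (pathEdges-sym verts)

  path⊆E : pathEdges verts ⊆ᴱ E
  path⊆E = pathEdges-⊆ symE c (m ++ [ z ]) (proj₂ isPath)

  interior-edges : ∀ {w t} → w ∈ m → E w t ≡ true → pathEdges verts w t ≡ true
  interior-edges {w} {t} w∈m e with pathEdges verts w t in off-path
  ... | true  = refl
  ... | false with interior-neighbours c m z (proj₁ isPath) w∈m
  ...   | p , q , wp , wq , p≢q = ⊥-elim (1+n≰n (≤-trans three-neighbours (≤-reflexive (degree-2 w∈m))))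
    where
      differs : ∀ {s} → pathEdges verts w s ≡ true → s ≢ t
      differs ws refl = false≢true (trans (sym off-path) ws)
      three-neighbours : 3 ≤ degIn E w
      three-neighbours =
        card-≥ (E w) (p ∷ q ∷ t ∷ [])
               ((p≢q ∷ differs wp ∷ []) ∷ (differs wq ∷ []) ∷ [] ∷ [])
               (path⊆E w p wp ∷ path⊆E w q wq ∷ e ∷ [])

  endpoints : ∀ {s t} → pathEdges verts s t ≡ true → s ∉ m → s ≡ c ⊎ s ≡ z
  endpoints {s} {t} st s∉m with proj₁ (pathEdges-ends c (m ++ [ z ]) s t st)
  ... | here s≡c = inj₁ s≡c
  ... | there s∈ with ∈-++⁻ m s∈
  ...   | inj₁ s∈m        = ⊥-elim (s∉m s∈m)
  ...   | inj₂ (here s≡z) = inj₂ s≡z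

  open DecMembership (Fin._≟_ {n}) using (_∈?_)

  Exit : Fin n → Fin n → Set
  Exit v t = Reach rest v c ⊎ Reach rest v z ⊎ Reach rest v t

  exit-step : ∀ {v w t} → rest v w ≡ true → Exit w t → Exit v t
  exit-step e = Sum.map (reach-trans (reach-edge e)) (Sum.map (reach-trans (reach-edge e)) (reach-trans (reach-edge e)))

  exits : ∀ {v t k} → v ∉ m → Walk E v t k → Exit v t
  exits v∉m here = inj₂ (inj₂ reach-refl)
  exits {v} v∉m (step {v = w} e walk) with pathEdges verts v w in vw
  ... | true with endpoints vw v∉m
  ...   | inj₁ refl = inj₁ reach-refl
  ...   | inj₂ refl = inj₂ (inj₁ reach-refl)
  exits {v} v∉m (step {v = w} e walk) | false with w ∈? m
  ...   | yes w∈m = ⊥-elim (false≢true (trans (sym vw)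
                      (pathEdges-sym verts w v (interior-edges w∈m (symE v w e)))))
  ...   | no w∉m = exit-step (∧-intro e (not-intro vw)) (exits w∉m walk)

module _ {A : Set} where

  chain-suffix : ∀ {R : A → A → Set} (xs : List A) {x ys} → Linked R (xs ++ x ∷ ys) → Linked R (x ∷ ys)
  chain-suffix []       linked = linked
  chain-suffix (_ ∷ xs) linked = chain-suffix xs (Linked.tail linked)

  chain-prefix : ∀ {R : A → A → Set} (xs : List A) {x ys} → Linked R (xs ++ x ∷ ys) → Linked R (xs ++ [ x ])
  chain-prefix []           _            = [-]
  chain-prefix (_ ∷ [])     (r ∷ _)      = r ∷ [-]
  chain-prefix (_ ∷ y ∷ xs) (r ∷ linked) = r ∷ chain-prefix (y ∷ xs) linked

  snoc-as-cons : (xs : List A) (x : A) → ∃[ c ] ∃[ r ] (xs ++ [ x ] ≡ c ∷ r × length r ≡ length xs)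
  snoc-as-cons []       x = x , [] , refl , refl
  snoc-as-cons (y ∷ xs) x = y , xs ++ [ x ] , refl , trans (length-++ xs) (+-comm (length xs) 1)

  head-in-prefix : ∀ {a rest} (xs : List A) {x ys} → a ∷ rest ≡ xs ++ x ∷ ys → a ∈ xs ++ [ x ]
  head-in-prefix []       eq = here (∷-injectiveˡ eq)
  head-in-prefix (_ ∷ xs) eq = here (∷-injectiveˡ eq)

  last-in-suffix : ∀ (xs : List A) {x ys} ms {b} → xs ++ x ∷ ys ≡ ms ++ [ b ] → b ∈ x ∷ ys
  last-in-suffix []       ms       eq = subst (_ ∈_) (sym eq) (∈-++⁺ʳ ms (here refl))
  last-in-suffix (_ ∷ [])     [] eq with () ← ∷-injectiveʳ eq
  last-in-suffix (_ ∷ _ ∷ _)  [] eq with () ← ∷-injectiveʳ eq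
  last-in-suffix (_ ∷ xs) (_ ∷ ms) eq = last-in-suffix xs ms (∷-injectiveʳ eq)

  split-length : ∀ (xs : List A) {x ys c ms b} → c ∷ ms ++ [ b ] ≡ xs ++ x ∷ ys →
                 length xs + length ys ≡ suc (length ms)
  split-length xs {x} {ys} {ms = ms} {b} eq = suc-injective (begin
      suc (length xs + length ys)   ≡⟨ sym (+-suc (length xs) (length ys)) ⟩
      length xs + length (x ∷ ys)   ≡⟨ sym (length-++ xs) ⟩
      length (xs ++ x ∷ ys)         ≡⟨ cong length (sym eq) ⟩
      suc (length (ms ++ [ b ]))    ≡⟨ cong suc (trans (length-++ ms) (+-comm (length ms) 1)) ⟩
      suc (suc (length ms))         ∎)
    where open ≡-Reasoning

-- Deleting the edges of P₀ splits T₀ into the side of a and the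
-- side of b; a terminal u close to a vertex x of P₀ lets us trade the
-- part of P₀ between x and u's side for a walk from x to u.

module Exchange {n : ℕ} {G : Graph n} {U₀ : VSet n} {T₀ : SubTree G}
                (steiner : IsSteinerTree G U₀ T₀) (P₀ : Segment U₀ T₀) where

  open Segment P₀

  not-interior : ∀ {v} → v ∈ₛ U₀ → v ∉ mid
  not-interior v∈U₀ v∈mid = All.lookup inner v∈mid (inj₁ v∈U₀)

  interior-degree : ∀ {w} → w ∈ mid → degIn (ET T₀) w ≡ 2
  interior-degree {w} w∈mid with degIn (ET T₀) w ℕ.≟ 2
  ... | yes deg≡2 = deg≡2
  ... | no  deg≢2 with interior-neighbours a mid b (proj₁ path) w∈mid
  ...   | p , _ , wp , _ = ⊥-elim (All.lookup inner w∈mid (inj₂ (w∈T₀ , deg≢2)))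
    where
      w∈T₀ : w ∈ₛ VT T₀
      w∈T₀ = ET-ends T₀ w p (pathEdges-⊆ (ET-sym T₀) a (mid ++ [ b ]) (proj₂ path) w p wp)

  open PathCut (ET-sym T₀) a mid b path interior-degree

  a∈T₀ : a ∈ₛ VT T₀
  a∈T₀ with mid | proj₂ path
  ... | []    | e ∷ _ = ET-ends T₀ a _ e
  ... | _ ∷ _ | e ∷ _ = ET-ends T₀ a _ e

  side : ∀ {v} → v ∈ₛ VT T₀ → v ∉ mid → Reach rest v a ⊎ Reach rest v b
  side v∈T₀ v∉mid with exits v∉mid (proj₂ (conn T₀ _ a v∈T₀ a∈T₀))
  ... | inj₁ v~a          = inj₁ v~a
  ... | inj₂ (inj₁ v~b)   = inj₂ v~b
  ... | inj₂ (inj₂ v~a)   = inj₁ v~a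

  Covered : Fin n → Fin n → List (Fin n) → Fin n → Set
  Covered u c r e = Reach rest e u ⊎ e ∈ c ∷ r

  module Rerouted {x u k} (u∈U₀ : u ∈ₛ U₀) (walk : Walk (adj G) x u k)
                  (c : Fin n) (r : List (Fin n)) (kept : Chain (ET T₀) (c ∷ r)) (x∈kept : x ∈ c ∷ r)
                  (covered-a : Covered u c r a) (covered-b : Covered u c r b) where

    walked : List (Fin n)
    walked = x ∷ walkTail walk

    E′ : ERel n
    E′ = rest ∪ᴱ pathEdges (c ∷ r) ∪ᴱ pathEdges walked

    rest⊆E′ : rest ⊆ᴱ E′
    rest⊆E′ s t h = ∨-introˡ (∨-introˡ h)

    kept⊆E′ : pathEdges (c ∷ r) ⊆ᴱ E′
    kept⊆E′ s t h = ∨-introˡ (∨-introʳ {rest s t} h)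

    walked⊆E′ : pathEdges walked ⊆ᴱ E′
    walked⊆E′ s t h = ∨-introʳ {(rest ∪ᴱ pathEdges (c ∷ r)) s t} h

    kept-to-x : ∀ {s} → s ∈ c ∷ r → Reach E′ s x
    kept-to-x s∈ = reach-mono kept⊆E′
      (reach-trans (reach-sym (pathEdges-sym (c ∷ r)) (pathEdges-reach c r s∈)) (pathEdges-reach c r x∈kept))

    walked-to-x : ∀ {s} → s ∈ walked → Reach E′ s x
    walked-to-x s∈ = reach-mono walked⊆E′ (reach-sym (pathEdges-sym walked) (pathEdges-reach x _ s∈))

    end-to-x : ∀ {e} → Covered u c r e → Reach E′ e x
    end-to-x (inj₁ e~u) = reach-trans (reach-mono rest⊆E′ e~u) (walked-to-x (walkTail-end walk))
    end-to-x (inj₂ e∈)  = kept-to-x e∈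

    tree-to-x : ∀ {v} → v ∈ₛ VT T₀ → v ∉ mid → Reach E′ v x
    tree-to-x v∈T₀ v∉mid with side v∈T₀ v∉mid
    ... | inj₁ v~a = reach-trans (reach-mono rest⊆E′ v~a) (end-to-x covered-a)
    ... | inj₂ v~b = reach-trans (reach-mono rest⊆E′ v~b) (end-to-x covered-b)

    edge-to-x : ∀ {v w} → E′ v w ≡ true → Reach E′ v x
    edge-to-x {v} {w} e with ∨-elim {(rest ∪ᴱ pathEdges (c ∷ r)) v w} e
    ... | inj₂ on-walk = walked-to-x (proj₁ (pathEdges-ends x _ v w on-walk))
    ... | inj₁ e₁ with ∨-elim {rest v w} e₁
    ...   | inj₂ on-kept = kept-to-x (proj₁ (pathEdges-ends c r v w on-kept))
    ...   | inj₁ in-rest with ∧-elim {ET T₀ v w} in-rest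
    ...     | vw , off-path = tree-to-x (ET-ends T₀ v w vw) v∉mid
      where
        v∉mid : v ∉ mid
        v∉mid v∈mid = false≢true (trans (sym (not-elim off-path)) (interior-edges v∈mid vw))

    connects : Connects G U₀ E′
    connects = record
      { inG       = λ s t h → inG-cases s t (∨-elim {(rest ∪ᴱ pathEdges (c ∷ r)) s t} h)
      ; symmetric = ∪-sym (∪-sym rest-sym (pathEdges-sym (c ∷ r))) (pathEdges-sym walked)
      ; hub       = x
      ; toHub     = λ v → λ where
          (inj₁ v∈U₀)    → tree-to-x (proj₁ steiner v v∈U₀) (not-interior v∈U₀)
          (inj₂ (w , e)) → edge-to-x e
      }
      where
        inG-cases : ∀ s t → (rest ∪ᴱ pathEdges (c ∷ r)) s t ≡ true ⊎ pathEdges walked s t ≡ true →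
                    adj G s t ≡ true
        inG-cases s t (inj₂ h) = pathEdges-⊆ (Graph.sym G) x _ (walkTail-chain walk) s t h
        inG-cases s t (inj₁ h) with ∨-elim {rest s t} h
        ... | inj₁ h′ = ET⊆G T₀ s t (∖-⊆ (ET T₀) (pathEdges verts) s t h′)
        ... | inj₂ h′ = ET⊆G T₀ s t (pathEdges-⊆ (ET-sym T₀) c r kept s t h′)

    size : edgeCount E′ ≤ edgeCount rest + (length r + k)
    size = begin
        edgeCount E′
          ≤⟨ edgeCount-∪-path (rest ∪ᴱ pathEdges (c ∷ r)) x (walkTail walk) ⟩
        edgeCount (rest ∪ᴱ pathEdges (c ∷ r)) + length (walkTail walk)
          ≤⟨ +-mono-≤ (edgeCount-∪-path rest c r) (≤-reflexive (walkTail-length walk)) ⟩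
        edgeCount rest + length r + k
          ≡⟨ +-assoc (edgeCount rest) (length r) k ⟩
        edgeCount rest + (length r + k) ∎
      where open ≤-Reasoning

  -- minimality of T₀: the rerouted edge set saves no edges over P₀
  reroute : ∀ {x u k} → u ∈ₛ U₀ → (walk : Walk (adj G) x u k) →
            ∀ c r → Chain (ET T₀) (c ∷ r) → x ∈ c ∷ r →
            Covered u c r a → Covered u c r b → segLen P₀ ≤ length r + k
  reroute {x} {u} {k} u∈U₀ walk c r kept x∈kept covered-a covered-b =
    +-cancelˡ-≤ (edgeCount rest) (segLen P₀) (length r + k) (begin
      edgeCount rest + segLen P₀
        ≡⟨ cong (edgeCount rest +_) segLen-edges ⟩
      edgeCount rest + length (mid ++ [ b ])
        ≤⟨ edgeCount-∖-path (ET T₀) (ET-sym T₀) a (mid ++ [ b ]) (proj₁ path) (proj₂ path) ⟩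
      edgeCount (ET T₀)
        ≤⟨ steiner-bound {S = U₀} {T₀ = T₀} steiner u∈U₀ connects ⟩
      edgeCount E′
        ≤⟨ size ⟩
      edgeCount rest + (length r + k) ∎)
    where
      open ≤-Reasoning
      open Rerouted u∈U₀ walk c r kept x∈kept covered-a covered-b
      segLen-edges : segLen P₀ ≡ length (mid ++ [ b ])
      segLen-edges = sym (trans (length-++ mid) (+-comm (length mid) 1))

  split-chain : ∀ {A B x} → segVerts P₀ ≡ A ++ x ∷ B → Chain (ET T₀) (A ++ x ∷ B)
  split-chain split = subst (Chain (ET T₀)) split (proj₂ path)

  terminal-far : ∀ (A : List (Fin n)) {B x u k} → segVerts P₀ ≡ A ++ x ∷ B → u ∈ₛ U₀ →
                 Walk (adj G) x u k → length A ≤ k ⊎ length B ≤ k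
  terminal-far A {B} {x} {u} {k} split u∈U₀ walk
    with side (proj₁ steiner u u∈U₀) (not-interior u∈U₀)
  ... | inj₁ u~a = inj₁ (+-cancelʳ-≤ (length B) (length A) k (begin
      length A + length B   ≡⟨ split-length A split ⟩
      segLen P₀             ≤⟨ reroute u∈U₀ walk x B (chain-suffix A (split-chain split)) (here refl) covered-a covered-b ⟩
      length B + k          ≡⟨ +-comm (length B) k ⟩
      k + length B          ∎))
    where
      open ≤-Reasoning
      covered-a : Covered u x B a
      covered-a = inj₁ (reach-sym rest-sym u~a)
      covered-b : Covered u x B b
      covered-b = inj₂ (last-in-suffix A (a ∷ mid) (sym split))
  ... | inj₂ u~b with snoc-as-cons A x
  ...   | c , r , prefix , r≡A = inj₂ (+-cancelˡ-≤ (length A) (length B) k (begin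
      length A + length B   ≡⟨ split-length A split ⟩
      segLen P₀             ≤⟨ reroute u∈U₀ walk c r kept x∈kept covered-a covered-b ⟩
      length r + k          ≡⟨ cong (_+ k) r≡A ⟩
      length A + k          ∎))
    where
      open ≤-Reasoning
      kept : Chain (ET T₀) (c ∷ r)
      kept = subst (Chain (ET T₀)) prefix (chain-prefix A (split-chain split))
      x∈kept : x ∈ c ∷ r
      x∈kept = subst (x ∈_) prefix (∈-++⁺ʳ A (here refl))
      covered-a : Covered u c r a
      covered-a = inj₂ (subst (a ∈_) prefix (head-in-prefix A split))
      covered-b : Covered u c r b
      covered-b = inj₁ (reach-sym rest-sym u~b)

half-≤-parts : ∀ L p q → p + q ≡ L → (p ≡ L / 2 ⊎ q ≡ L / 2) → L / 2 ≤ p × L / 2 ≤ q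
half-≤-parts L p q p+q≡L (inj₁ refl) =
  ≤-refl , +-cancelˡ-≤ (L / 2) (L / 2) q (subst (L / 2 + L / 2 ≤_) (sym p+q≡L) (two-halves L))
  where
    two-halves : ∀ L → L / 2 + L / 2 ≤ L
    two-halves L = subst (_≤ L) (trans (*-comm (L / 2) 2) (cong (L / 2 +_) (+-identityʳ (L / 2)))) (m/n*n≤m L 2)
half-≤-parts L p q p+q≡L (inj₂ refl) =
  Product.swap (half-≤-parts L q p (trans (+-comm q p) p+q≡L) (inj₁ refl))

nearby-terminal : ∀ {n} {G : Graph n} {U U₀ U₀bar : VSet n} {dU} → UConditions G U U₀ U₀bar dU →
                  ∀ {x y i} → Walk (adj G) x y i → y ∈ₛ U →
                  ∃[ u ] (u ∈ₛ U₀ × ∃[ k ] (k ≤ i + dU × Walk (adj G) x u k))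
nearby-terminal uc {i = i} x~y y∈U with proj₁ (UConditions.union uc _) y∈U
... | inj₁ y∈U₀ = _ , y∈U₀ , i , m≤m+n i _ , x~y
... | inj₂ y∈U₀bar with UConditions.near uc _ y∈U₀bar
...   | u , u∈U₀ , j , j≤dU , y~u = u , u∈U₀ , i + j , +-monoʳ-≤ i j≤dU , walk-++ x~y y~u

lemma20 : ∀ {n} (G : Graph n) → SphereTriangulation G →
    (U U₀ U₀bar : VSet n) (dU : ℕ) → UConditions G U U₀ U₀bar dU →
    2 ≤ card U₀ →
    (T₀ : SubTree G) → IsSteinerTree G U₀ T₀ →
    (P₀ : Segment U₀ T₀) → (∀ (Q : Segment U₀ T₀) → segLen Q ≤ segLen P₀) →
    (x : Fin n) →
    (∃[ A ] ∃[ B ] (segVerts P₀ ≡ A ++ x ∷ B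
    × (length A ≡ segLen P₀ / 2 ⊎ length B ≡ segLen P₀ / 2))) →
    ∀ (i : ℕ) → i + dU < segLen P₀ / 2 →
    ∀ (y : Fin n) → N G i x y → ¬ (y ∈ₛ U)
lemma20 G _ U U₀ U₀bar dU uc _ T₀ steiner P₀ _ x (A , B , split , middle) i close y (x~y , _) y∈U
  with nearby-terminal uc x~y y∈U
... | u , u∈U₀ , k , k≤ , walk = <-irrefl refl (≤-<-trans half≤k (≤-<-trans k≤ close))
  where
    half≤A×half≤B : segLen P₀ / 2 ≤ length A × segLen P₀ / 2 ≤ length B
    half≤A×half≤B = half-≤-parts (segLen P₀) (length A) (length B) (split-length A split) middle
    half≤k : segLen P₀ / 2 ≤ k
    half≤k with Exchange.terminal-far steiner P₀ A split u∈U₀ walk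
    ... | inj₁ A≤k = ≤-trans (proj₁ half≤A×half≤B) A≤k
    ... | inj₂ B≤k = ≤-trans (proj₂ half≤A×half≤B) B≤k
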